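{- Let $G=(V,E)$ be a finite graph with maximum degree at most $2$ and let $n\geq 1$ be an integer. Then $I_n(G)$ is $2(n-1)$-collapsible.
   Context: For a graph $G=(V,E)$, $I_n(G)=\{U\subseteq V:\ \alpha(G[U])<n\}$, where $\alpha$ is the independence number. For a finite simplicial complex $X$, a face $\sigma$ contained in a unique maximal face $\tau$ is a free face; if $|\sigma|\leq d$, removing all faces $\eta$ with $\sigma\subseteq\eta\subseteq\tau$ is an elementary $d$-collapse. $X$ is $d$-collapsible if a sequence of elementary $d$-collapses reduces it to the void complex (no faces at all). -}

module Defs where

open import Data.Nat using (ℕ; _<_; _≤_)
open import Data.Fin using (Fin)
open import Data.Fin.Subset using (Subset; _∈_; _∉_; _⊆_; ∣_∣)
open import Data.Product using (_×_)
open import Relation.Nullary using (¬_)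
open import Relation.Binary.PropositionalEquality using (_≡_)

record Graph (m : ℕ) : Set where
  field
    N     : Fin m → Subset m
    sym   : ∀ {i j} → j ∈ N i → i ∈ N j
    irrefl : ∀ i → i ∉ N i

open Graph public

Adj : ∀ {m} → Graph m → Fin m → Fin m → Set
Adj G i j = j ∈ N G i

degree : ∀ {m} → Graph m → Fin m → ℕ
degree G i = ∣ N G i ∣

MaxDegreeAtMost : ∀ {m} → ℕ → Graph m → Set
MaxDegreeAtMost k G = ∀ i → degree G i ≤ k

Independent : ∀ {m} → Graph m → Subset m → Set
Independent G I = ∀ {i j} → i ∈ I → j ∈ I → ¬ Adj G i j

-- α(G[U]) < n : every independent set of the induced subgraph G[U]
-- (i.e. every independent set of G contained in U) has fewer than n vertices.
αLess : ∀ {m} → Graph m → Subset m → ℕ → Set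
αLess G U n = ∀ I → I ⊆ U → Independent G I → ∣ I ∣ < n

-- A (finite, abstract) simplicial complex on Fin m: a down-closed family of faces.
-- (Down-closure is not needed for the collapse notion below, so a family of faces
--  is represented by its membership predicate.)
Family : ℕ → Set₁
Family m = Subset m → Set

IsComplex : ∀ {m} → Family m → Set
IsComplex K = ∀ σ τ → K τ → σ ⊆ τ → K σ

In : ∀ {m} → ℕ → Graph m → Family m
In n G U = αLess G U n

MaximalFace : ∀ {m} → Family m → Subset m → Set
MaximalFace K τ = K τ × (∀ η → K η → τ ⊆ η → η ≡ τ)

FreeFaceIn : ∀ {m} → Family m → Subset m → Subset m → Set
FreeFaceIn K σ τ = MaximalFace K τ × σ ⊆ τ × (∀ τ' → MaximalFace K τ' → σ ⊆ τ' → τ' ≡ τ)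

collapse : ∀ {m} → Family m → Subset m → Subset m → Family m
collapse K σ τ η = K η × ¬ (σ ⊆ η × η ⊆ τ)

Void : ∀ {m} → Family m → Set
Void K = ∀ η → ¬ K η

data Collapsible {m : ℕ} (d : ℕ) : Family m → Set₁ where
  void : ∀ {K} → Void K → Collapsible d K
  step : ∀ {K} σ τ → FreeFaceIn K σ τ → ∣ σ ∣ ≤ d
       → Collapsible d (collapse K σ τ) → Collapsible d K

-- If the link of a vertex v in a complex K is e-collapsible and the deletion of v is
-- (e+1)-collapsible, then K is (e+1)-collapsible: every free pair σ ⊆ τ of the link lifts to the
-- free pair σ ∪ v ⊆ τ ∪ v of K. A cone is as collapsible as its base.
--
-- Write Ind W n for I_n(G[W]). Induction on |W| shows that Ind W (j+1) is 2j-collapsible. The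
-- deletion of v from Ind W (j+2) is Ind (W - v) (j+2), and its link is Lk (W - v) (j+1) (N v),
-- the η ⊆ W - v with α(η) < j+2 and α(η - N v) < j+1. Lk W (j+1) S is (2j+1)-collapsible as soon
-- as at most two vertices of S lie in W, each with a neighbour outside W (for S = N v this is
-- deg v ≤ 2). With no such vertex it is Ind W (j+1); with one, b, it is a cone with apex b over
-- Ind (W - b) (j+1); with two, a and b, split at a: the deletion is again a cone with apex b, and
-- so is the link when a ~ b. Otherwise the link is {∅} if j = 0, and else it has deletion
-- Ind (W - a - b) (j+1) and link Lk (W - a - b) j (N a ∪ N b) at b, where a and b have at most one
-- further neighbour each.

module Submission where

open import Defs hiding (sym)
open import Data.Nat using (ℕ; zero; suc; _+_; _*_; _∸_; _≤_; _<_; z≤n; s≤s)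
open import Data.Nat.Properties
  using (≤-trans; ≤-reflexive; <-≤-trans; ≤-<-trans; ≤-pred; n≤1+n; n≮0; +-suc; +-comm; *-suc)
open import Data.Fin using (Fin; _≟_)
open import Data.Fin.Subset
  using (Subset; _∈_; _∉_; _⊆_; ∣_∣; _∪_; _∩_; _─_; _-_; ⁅_⁆; ⊥; ⊤; Empty; inside; outside)
open import Data.Fin.Subset.Properties
  using ( _∈?_; nonempty?; ⊆-refl; ⊆-trans; ⊆-antisym; ⊆-reflexive; ⊆-min; ⊆⊤; ∉⊥; Empty-unique
        ; x∈⁅x⁆; x∈⁅y⁆⇒x≡y; ∣⁅x⁆∣≡1; ∣⊥∣≡0; ∣p∣≤n; p⊆q⇒∣p∣≤∣q∣; p⊂q⇒∣p∣<∣q∣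
        ; p⊆p∪q; q⊆p∪q; x∈p∪q⁻; x∈p∩q⁺; x∈p∩q⁻; ∣p∩q∣≤∣p∣; ∩-distribʳ-∪
        ; p─q⊆p; x∈p∧x∉q⇒x∈p─q; x∈p∧x≢y⇒x∈p-y; p─q─r≡p─q∪r; ∣p─q∣≤∣p∣; x∈p⇒∣p-x∣<∣p∣ )
open import Data.Vec using ([]; _∷_; here; there)
open import Data.Product using (_×_; _,_; proj₁; proj₂; ∃-syntax)
open import Data.Sum using (_⊎_; inj₁; inj₂)
open import Function using (_∘_; _⇔_; mk⇔; Equivalence)
open import Relation.Nullary using (¬_; yes; no; contradiction)
open import Relation.Nullary.Decidable using (decidable-stable)
open import Relation.Unary using (_≐_)
open import Relation.Unary.Properties using (≐-sym; ≐-trans)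
open import Relation.Binary.PropositionalEquality
  using (_≡_; _≢_; refl; sym; trans; cong; subst)

open Equivalence using (to; from)

x∈p─q⇒x∉q : ∀ {n} {p q : Subset n} {x} → x ∈ p ─ q → x ∉ q
x∈p─q⇒x∉q {p = _ ∷ _} {inside  ∷ _} ()          here
x∈p─q⇒x∉q {p = _ ∷ _} {outside ∷ _} here        ()
x∈p─q⇒x∉q {p = _ ∷ _} {_       ∷ _} (there x∈) (there x∈q) = x∈p─q⇒x∉q x∈ x∈q

∣p∣≤∣p─q∣+∣q∣ : ∀ {n} (p q : Subset n) → ∣ p ∣ ≤ ∣ p ─ q ∣ + ∣ q ∣
∣p∣≤∣p─q∣+∣q∣ []            []            = z≤n
∣p∣≤∣p─q∣+∣q∣ (inside  ∷ p) (inside  ∷ q) =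
  ≤-trans (s≤s (∣p∣≤∣p─q∣+∣q∣ p q)) (≤-reflexive (sym (+-suc _ _)))
∣p∣≤∣p─q∣+∣q∣ (outside ∷ p) (inside  ∷ q) =
  ≤-trans (≤-trans (∣p∣≤∣p─q∣+∣q∣ p q) (n≤1+n _)) (≤-reflexive (sym (+-suc _ _)))
∣p∣≤∣p─q∣+∣q∣ (inside  ∷ p) (outside ∷ q) = s≤s (∣p∣≤∣p─q∣+∣q∣ p q)
∣p∣≤∣p─q∣+∣q∣ (outside ∷ p) (outside ∷ q) = ∣p∣≤∣p─q∣+∣q∣ p q

module _ {m : ℕ} where

  Empty-⊥ : Empty (⊥ {m})
  Empty-⊥ (_ , x∈⊥) = ∉⊥ x∈⊥

  Disjoint : Subset m → Subset m → Set
  Disjoint p q = ∀ {x} → x ∈ p → x ∉ q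

  x∈p-y⇒x≢y : ∀ {p : Subset m} {x y} → x ∈ p - y → x ≢ y
  x∈p-y⇒x≢y {y = y} x∈p-y refl = x∈p─q⇒x∉q x∈p-y (x∈⁅x⁆ y)

  x∉p-x : ∀ {p : Subset m} {x} → x ∉ p - x
  x∉p-x x∈p-x = x∈p-y⇒x≢y x∈p-x refl

  x∈p∪⁅x⁆ : ∀ (p : Subset m) {x} → x ∈ p ∪ ⁅ x ⁆
  x∈p∪⁅x⁆ p {x} = q⊆p∪q p ⁅ x ⁆ (x∈⁅x⁆ x)

  x∈p∪⁅y⁆⁻ : ∀ (p : Subset m) {x y} → x ∈ p ∪ ⁅ y ⁆ → x ∈ p ⊎ x ≡ y
  x∈p∪⁅y⁆⁻ p {y = y} x∈p∪y with x∈p∪q⁻ p ⁅ y ⁆ x∈p∪y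
  ... | inj₁ x∈p = inj₁ x∈p
  ... | inj₂ x∈y = inj₂ (x∈⁅y⁆⇒x≡y y x∈y)

  p∪⁅x⁆⊆q : ∀ {p q : Subset m} {x} → p ⊆ q → x ∈ q → p ∪ ⁅ x ⁆ ⊆ q
  p∪⁅x⁆⊆q {p} p⊆q x∈q y∈p∪x with x∈p∪⁅y⁆⁻ p y∈p∪x
  ... | inj₁ y∈p = p⊆q y∈p
  ... | inj₂ refl = x∈q

  ∪⁅⁆-mono : ∀ {p q : Subset m} {x} → p ⊆ q → p ∪ ⁅ x ⁆ ⊆ q ∪ ⁅ x ⁆
  ∪⁅⁆-mono {q = q} p⊆q = p∪⁅x⁆⊆q (⊆-trans p⊆q (p⊆p∪q _)) (x∈p∪⁅x⁆ q)

  ⊆∪⁅x⁆⇒⊆ : ∀ {p q : Subset m} {x} → x ∉ p → p ⊆ q ∪ ⁅ x ⁆ → p ⊆ q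
  ⊆∪⁅x⁆⇒⊆ {q = q} x∉p p⊆q∪x y∈p with x∈p∪⁅y⁆⁻ q (p⊆q∪x y∈p)
  ... | inj₁ y∈q = y∈q
  ... | inj₂ refl = contradiction y∈p x∉p

  ⊆∪⁅x⁆⇔⊆ : ∀ {p q : Subset m} {x} → x ∉ p → p ⊆ q ∪ ⁅ x ⁆ ⇔ p ⊆ q
  ⊆∪⁅x⁆⇔⊆ x∉p = mk⇔ (⊆∪⁅x⁆⇒⊆ x∉p) (λ p⊆q → ⊆-trans p⊆q (p⊆p∪q _))

  ∪⁅x⁆⊆∪⁅x⁆⇔⊆ : ∀ {p q : Subset m} {x} → x ∉ p → p ∪ ⁅ x ⁆ ⊆ q ∪ ⁅ x ⁆ ⇔ p ⊆ q
  ∪⁅x⁆⊆∪⁅x⁆⇔⊆ {p} {q} {x} x∉p = mk⇔ shrink ∪⁅⁆-mono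
    where
    shrink : p ∪ ⁅ x ⁆ ⊆ q ∪ ⁅ x ⁆ → p ⊆ q
    shrink p∪x⊆q∪x = ⊆∪⁅x⁆⇒⊆ x∉p (⊆-trans (p⊆p∪q _) p∪x⊆q∪x)

  ⊆⇒⊆-x : ∀ {p q : Subset m} {x} → x ∉ p → p ⊆ q → p ⊆ q - x
  ⊆⇒⊆-x x∉p p⊆q y∈p = x∈p∧x≢y⇒x∈p-y (p⊆q y∈p) λ { refl → x∉p y∈p }

  p-x⊆q⇒p⊆q∪⁅x⁆ : ∀ {p q : Subset m} {x} → p - x ⊆ q → p ⊆ q ∪ ⁅ x ⁆
  p-x⊆q⇒p⊆q∪⁅x⁆ {q = q} {x} p-x⊆q {y} y∈p with y ≟ x
  ... | yes refl = x∈p∪⁅x⁆ q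
  ... | no y≢x = p⊆p∪q _ (p-x⊆q (x∈p∧x≢y⇒x∈p-y y∈p y≢x))

  p-x∪⁅x⁆≡p : ∀ {p : Subset m} {x} → x ∈ p → (p - x) ∪ ⁅ x ⁆ ≡ p
  p-x∪⁅x⁆≡p x∈p = ⊆-antisym (p∪⁅x⁆⊆q (p─q⊆p _ _) x∈p) (p-x⊆q⇒p⊆q∪⁅x⁆ ⊆-refl)

  p∪⁅x⁆-x≡p : ∀ {p : Subset m} {x} → x ∉ p → (p ∪ ⁅ x ⁆) - x ≡ p
  p∪⁅x⁆-x≡p x∉p = ⊆-antisym (⊆∪⁅x⁆⇒⊆ x∉p-x (p─q⊆p _ _)) (⊆⇒⊆-x x∉p (p⊆p∪q _))

  ─-monoˡ : ∀ {p p′ q : Subset m} → p ⊆ p′ → p ─ q ⊆ p′ ─ q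
  ─-monoˡ {p} {q = q} p⊆p′ x∈p─q = x∈p∧x∉q⇒x∈p─q (p⊆p′ (p─q⊆p p q x∈p─q)) (x∈p─q⇒x∉q x∈p─q)

  p∪⁅x⁆─q⊆p─q : ∀ {p q : Subset m} {x} → x ∈ q → p ∪ ⁅ x ⁆ ─ q ⊆ p ─ q
  p∪⁅x⁆─q⊆p─q {p} {q} {x} x∈q y∈ with x∈p∪⁅y⁆⁻ p (p─q⊆p (p ∪ ⁅ x ⁆) q y∈)
  ... | inj₁ y∈p = x∈p∧x∉q⇒x∈p─q y∈p (x∈p─q⇒x∉q y∈)
  ... | inj₂ refl = contradiction x∈q (x∈p─q⇒x∉q y∈)

  p∪⁅x⁆─q≡p─q∪⁅x⁆ : ∀ {p q : Subset m} {x} → x ∉ q → p ∪ ⁅ x ⁆ ─ q ≡ (p ─ q) ∪ ⁅ x ⁆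
  p∪⁅x⁆─q≡p─q∪⁅x⁆ {p} {q} {x} x∉q =
    ⊆-antisym ⊆₁ (p∪⁅x⁆⊆q (─-monoˡ (p⊆p∪q _)) (x∈p∧x∉q⇒x∈p─q (x∈p∪⁅x⁆ p) x∉q))
    where
    ⊆₁ : p ∪ ⁅ x ⁆ ─ q ⊆ (p ─ q) ∪ ⁅ x ⁆
    ⊆₁ y∈ with x∈p∪⁅y⁆⁻ p (p─q⊆p (p ∪ ⁅ x ⁆) q y∈)
    ... | inj₁ y∈p = p⊆p∪q _ (x∈p∧x∉q⇒x∈p─q y∈p (x∈p─q⇒x∉q y∈))
    ... | inj₂ refl = x∈p∪⁅x⁆ (p ─ q)

  ∣p∣≤1+∣p-x∣ : ∀ (p : Subset m) x → ∣ p ∣ ≤ suc ∣ p - x ∣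
  ∣p∣≤1+∣p-x∣ p x = ≤-trans (∣p∣≤∣p─q∣+∣q∣ p ⁅ x ⁆)
    (≤-reflexive (trans (cong (∣ p - x ∣ +_) (∣⁅x⁆∣≡1 x)) (+-comm _ 1)))

  ∣p∪⁅x⁆∣≤1+∣p∣ : ∀ (p : Subset m) {x} → ∣ p ∪ ⁅ x ⁆ ∣ ≤ suc ∣ p ∣
  ∣p∪⁅x⁆∣≤1+∣p∣ p {x} = ≤-trans (∣p∣≤1+∣p-x∣ (p ∪ ⁅ x ⁆) x)
    (s≤s (p⊆q⇒∣p∣≤∣q∣ (⊆∪⁅x⁆⇒⊆ x∉p-x (p─q⊆p (p ∪ ⁅ x ⁆) ⁅ x ⁆))))

  ∣p-x∣<k : ∀ {p : Subset m} {x k} → x ∈ p → ∣ p ∣ ≤ k → ∣ p - x ∣ < k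
  ∣p-x∣<k x∈p ∣p∣≤k = <-≤-trans (x∈p⇒∣p-x∣<∣p∣ x∈p) ∣p∣≤k

module _ {m : ℕ} where

  link : Family m → Fin m → Family m
  link K v η = v ∉ η × K (η ∪ ⁅ v ⁆)

  deletion : Family m → Fin m → Family m
  deletion K v η = v ∉ η × K η

  MaximalFace-resp-≐ : ∀ {K L : Family m} {τ} → K ≐ L → MaximalFace K τ → MaximalFace L τ
  MaximalFace-resp-≐ (K⊆L , L⊆K) (Kτ , maximal) = K⊆L Kτ , λ η Lη τ⊆η → maximal η (L⊆K Lη) τ⊆η

  FreeFaceIn-resp-≐ : ∀ {K L : Family m} {σ τ} → K ≐ L → FreeFaceIn K σ τ → FreeFaceIn L σ τ
  FreeFaceIn-resp-≐ K≐L (maxτ , σ⊆τ , unique) =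
    MaximalFace-resp-≐ K≐L maxτ , σ⊆τ ,
    λ τ′ maxτ′ σ⊆τ′ → unique τ′ (MaximalFace-resp-≐ (≐-sym K≐L) maxτ′) σ⊆τ′

  collapse-resp-≐ : ∀ {K L : Family m} {σ τ} → K ≐ L → collapse K σ τ ≐ collapse L σ τ
  collapse-resp-≐ (K⊆L , L⊆K) = (λ (Kη , out) → K⊆L Kη , out) , (λ (Lη , out) → L⊆K Lη , out)

  Collapsible-resp-≐ : ∀ {d} {K L : Family m} → K ≐ L → Collapsible d K → Collapsible d L
  Collapsible-resp-≐ (_ , L⊆K) (void voidK) = void λ η Lη → voidK η (L⊆K Lη)
  Collapsible-resp-≐ K≐L (step σ τ free ∣σ∣≤d rest) =
    step σ τ (FreeFaceIn-resp-≐ K≐L free) ∣σ∣≤d (Collapsible-resp-≐ (collapse-resp-≐ K≐L) rest)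

  Collapsible-mono : ∀ {d d′} {K : Family m} → d ≤ d′ → Collapsible d K → Collapsible d′ K
  Collapsible-mono d≤d′ (void voidK) = void voidK
  Collapsible-mono d≤d′ (step σ τ free ∣σ∣≤d rest) =
    step σ τ free (≤-trans ∣σ∣≤d d≤d′) (Collapsible-mono d≤d′ rest)

  emptyFaces⇒Collapsible : ∀ {d} {K : Family m} → K ⊥ → (∀ {η} → K η → Empty η) → Collapsible d K
  emptyFaces⇒Collapsible {d} {K} K⊥ empty =
    step ⊥ ⊥ free (≤-trans (≤-reflexive (∣⊥∣≡0 m)) z≤n)
      (void λ η (Kη , out) → out (⊆-min η , λ x∈η → contradiction (_ , x∈η) (empty Kη)))
    where
    free : FreeFaceIn K ⊥ ⊥
    free = (K⊥ , λ η Kη _ → Empty-unique (empty Kη)) , ⊆-refl ,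
           λ τ (Kτ , _) _ → Empty-unique (empty Kτ)

  module _ (v : Fin m) where

    link-face : ∀ {K : Family m} {η} → v ∈ η → K η → link K v (η - v)
    link-face {K} v∈η Kη = x∉p-x , subst K (sym (p-x∪⁅x⁆≡p v∈η)) Kη

    link-maximal⁺ : ∀ {K : Family m} {τ} → MaximalFace (link K v) τ → MaximalFace K (τ ∪ ⁅ v ⁆)
    link-maximal⁺ {K} {τ} ((v∉τ , Kτ∪v) , maximal) = Kτ∪v , λ η Kη τ∪v⊆η →
      let v∈η = τ∪v⊆η (x∈p∪⁅x⁆ τ)
          η-v≡τ = maximal (η - v) (link-face {K} v∈η Kη)
                                  (⊆⇒⊆-x v∉τ (⊆-trans (p⊆p∪q _) τ∪v⊆η))
      in trans (sym (p-x∪⁅x⁆≡p v∈η)) (cong (_∪ ⁅ v ⁆) η-v≡τ)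

    link-maximal⁻ : ∀ {K : Family m} {τ} → MaximalFace K τ → v ∈ τ → MaximalFace (link K v) (τ - v)
    link-maximal⁻ {K} {τ} (Kτ , maximal) v∈τ =
      link-face {K} v∈τ Kτ , λ η (v∉η , Kη∪v) τ-v⊆η →
        trans (sym (p∪⁅x⁆-x≡p v∉η)) (cong (_- v) (maximal (η ∪ ⁅ v ⁆) Kη∪v (p-x⊆q⇒p⊆q∪⁅x⁆ τ-v⊆η)))

    link-free⇒∉ : ∀ {K : Family m} {σ τ} → FreeFaceIn (link K v) σ τ → v ∉ σ
    link-free⇒∉ (((v∉τ , _) , _) , σ⊆τ , _) = v∉τ ∘ σ⊆τ

    link-unique : ∀ {K : Family m} {σ τ τ′} → v ∉ σ
                → (∀ τ″ → MaximalFace (link K v) τ″ → σ ⊆ τ″ → τ″ ≡ τ)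
                → MaximalFace K τ′ → v ∈ τ′ → σ ⊆ τ′ → τ′ ≡ τ ∪ ⁅ v ⁆
    link-unique v∉σ unique maxτ′ v∈τ′ σ⊆τ′ =
      trans (sym (p-x∪⁅x⁆≡p v∈τ′))
            (cong (_∪ ⁅ v ⁆) (unique _ (link-maximal⁻ maxτ′ v∈τ′) (⊆⇒⊆-x v∉σ σ⊆τ′)))

    link-free : ∀ {K : Family m} {σ τ} → FreeFaceIn (link K v) σ τ
              → FreeFaceIn K (σ ∪ ⁅ v ⁆) (τ ∪ ⁅ v ⁆)
    link-free {K} {σ} free@(maxτ , σ⊆τ , unique) =
      link-maximal⁺ maxτ , ∪⁅⁆-mono σ⊆τ , λ τ′ maxτ′ σ∪v⊆τ′ →
        link-unique (link-free⇒∉ {K} free) unique maxτ′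
                    (σ∪v⊆τ′ (x∈p∪⁅x⁆ σ)) (⊆-trans (p⊆p∪q _) σ∪v⊆τ′)

    cone-free : ∀ {K : Family m} {σ τ} → (∀ {η} → deletion K v η → link K v η)
              → FreeFaceIn (link K v) σ τ → FreeFaceIn K σ (τ ∪ ⁅ v ⁆)
    cone-free {K} {σ} {τ} dl⊆lk free@(maxτ , σ⊆τ , unique) =
      link-maximal⁺ maxτ , ⊆-trans σ⊆τ (p⊆p∪q _) , unique′
      where
      unique′ : ∀ τ′ → MaximalFace K τ′ → σ ⊆ τ′ → τ′ ≡ τ ∪ ⁅ v ⁆
      unique′ τ′ maxτ′@(Kτ′ , maximal) σ⊆τ′ with v ∈? τ′
      ... | yes v∈τ′ = link-unique (link-free⇒∉ {K} free) unique maxτ′ v∈τ′ σ⊆τ′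
      ... | no v∉τ′ = contradiction
        (subst (v ∈_) (maximal _ (proj₂ (dl⊆lk (v∉τ′ , Kτ′))) (p⊆p∪q _)) (x∈p∪⁅x⁆ τ′)) v∉τ′

    link-collapse : ∀ {K : Family m} {σ σ′ τ} → (∀ {η} → σ′ ⊆ η ∪ ⁅ v ⁆ ⇔ σ ⊆ η)
                  → link (collapse K σ′ (τ ∪ ⁅ v ⁆)) v ≐ collapse (link K v) σ τ
    link-collapse σ′⇔σ =
      (λ (v∉η , Kη∪v , out) → (v∉η , Kη∪v) , λ (σ⊆η , η⊆τ) →
        out (from σ′⇔σ σ⊆η , from (∪⁅x⁆⊆∪⁅x⁆⇔⊆ v∉η) η⊆τ)) ,
      (λ ((v∉η , Kη∪v) , out) → v∉η , Kη∪v , λ (σ′⊆η∪v , η∪v⊆τ∪v) →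
        out (to σ′⇔σ σ′⊆η∪v , to (∪⁅x⁆⊆∪⁅x⁆⇔⊆ v∉η) η∪v⊆τ∪v))

    deletion-collapse-∪⁅⁆ : ∀ {K : Family m} {σ τ}
                          → deletion K v ≐ deletion (collapse K (σ ∪ ⁅ v ⁆) τ) v
    deletion-collapse-∪⁅⁆ {σ = σ} =
      (λ (v∉η , Kη) → v∉η , Kη , λ (σ∪v⊆η , _) → v∉η (σ∪v⊆η (x∈p∪⁅x⁆ σ))) ,
      (λ (v∉η , Kη , _) → v∉η , Kη)

    deletion-collapse : ∀ {K : Family m} {σ τ}
                      → deletion (collapse K σ (τ ∪ ⁅ v ⁆)) v ≐ collapse (deletion K v) σ τ
    deletion-collapse =
      (λ (v∉η , Kη , out) → (v∉η , Kη) , λ (σ⊆η , η⊆τ) → out (σ⊆η , ⊆-trans η⊆τ (p⊆p∪q _))) ,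
      (λ ((v∉η , Kη) , out) → v∉η , Kη , λ (σ⊆η , η⊆τ∪v) → out (σ⊆η , ⊆∪⁅x⁆⇒⊆ v∉η η⊆τ∪v))

    link∧deletion⇒Collapsible : ∀ {e} {K L : Family m} → link K v ≐ L → Collapsible e L
                              → Collapsible (suc e) (deletion K v) → Collapsible (suc e) K
    link∧deletion⇒Collapsible {K = K} (lk⊆L , _) (void voidL) deletionK =
      Collapsible-resp-≐ (proj₂ , K⊆deletion) deletionK
      where
      K⊆deletion : ∀ {η} → K η → deletion K v η
      K⊆deletion {η} Kη with v ∈? η
      ... | no v∉η = v∉η , Kη
      ... | yes v∈η = contradiction (lk⊆L (link-face {K} v∈η Kη)) (voidL (η - v))
    link∧deletion⇒Collapsible {K = K} lk≐L (step σ τ free ∣σ∣≤e rest) deletionK =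
      step (σ ∪ ⁅ v ⁆) (τ ∪ ⁅ v ⁆) (link-free freeₗ) (≤-trans (∣p∪⁅x⁆∣≤1+∣p∣ σ) (s≤s ∣σ∣≤e))
        (link∧deletion⇒Collapsible
          (≐-trans (link-collapse {K} (∪⁅x⁆⊆∪⁅x⁆⇔⊆ (link-free⇒∉ {K} freeₗ)))
                   (collapse-resp-≐ lk≐L))
          rest
          (Collapsible-resp-≐ deletion-collapse-∪⁅⁆ deletionK))
      where
      freeₗ = FreeFaceIn-resp-≐ (≐-sym lk≐L) free

    cone⇒Collapsible : ∀ {e} {K L : Family m} → link K v ≐ L → deletion K v ≐ L
                     → Collapsible e L → Collapsible e K
    cone⇒Collapsible {K = K} (lk⊆L , _) (dl⊆L , _) (void voidL) = void noFace
      where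
      noFace : ∀ η → ¬ K η
      noFace η Kη with v ∈? η
      ... | no v∉η = voidL η (dl⊆L (v∉η , Kη))
      ... | yes v∈η = voidL (η - v) (lk⊆L (link-face {K} v∈η Kη))
    cone⇒Collapsible {K = K} lk≐L dl≐L (step σ τ free ∣σ∣≤e rest) =
      step σ (τ ∪ ⁅ v ⁆) (cone-free (proj₂ lk≐L ∘ proj₁ dl≐L) freeₗ) ∣σ∣≤e
        (cone⇒Collapsible
          (≐-trans (link-collapse {K} (⊆∪⁅x⁆⇔⊆ (link-free⇒∉ {K} freeₗ))) (collapse-resp-≐ lk≐L))
          (≐-trans deletion-collapse (collapse-resp-≐ dl≐L)) rest)
      where
      freeₗ = FreeFaceIn-resp-≐ (≐-sym lk≐L) free

module _ {m : ℕ} where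

  AtMostOne : Subset m → Set
  AtMostOne A = ∀ {x y} → x ∈ A → y ∈ A → x ≡ y

  AtMostTwo : Subset m → Set
  AtMostTwo A = ∀ {x y z} → x ∈ A → y ∈ A → z ∈ A → x ≡ y ⊎ x ≡ z ⊎ y ≡ z

  ∣p∣≤2⇒AtMostTwo : ∀ {A : Subset m} → ∣ A ∣ ≤ 2 → AtMostTwo A
  ∣p∣≤2⇒AtMostTwo {A} ∣A∣≤2 {x} {y} {z} x∈A y∈A z∈A with x ≟ y | x ≟ z | y ≟ z
  ... | yes x≡y | _       | _       = inj₁ x≡y
  ... | _       | yes x≡z | _       = inj₂ (inj₁ x≡z)
  ... | _       | _       | yes y≡z = inj₂ (inj₂ y≡z)
  ... | no x≢y  | no x≢z  | no y≢z  = contradiction (≤-trans 3≤∣A∣ ∣A∣≤2) λ { (s≤s (s≤s ())) }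
    where
    y∈A-x = x∈p∧x≢y⇒x∈p-y y∈A (x≢y ∘ sym)
    z∈A-x-y = x∈p∧x≢y⇒x∈p-y (x∈p∧x≢y⇒x∈p-y z∈A (x≢z ∘ sym)) (y≢z ∘ sym)
    3≤∣A∣ : 3 ≤ ∣ A ∣
    3≤∣A∣ = ≤-trans (s≤s (≤-trans (s≤s (≤-trans (s≤s z≤n) (x∈p⇒∣p-x∣<∣p∣ z∈A-x-y)))
                                  (x∈p⇒∣p-x∣<∣p∣ y∈A-x)))
                    (x∈p⇒∣p-x∣<∣p∣ x∈A)

  AtMostTwo⇒AtMostOne : ∀ {A B : Subset m} {u} → AtMostTwo A → u ∈ A → u ∉ B → AtMostOne (A ∩ B)
  AtMostTwo⇒AtMostOne {A} {B} ≤2 u∈A u∉B x∈ y∈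
    with x∈p∩q⁻ A B x∈ | x∈p∩q⁻ A B y∈
  ... | x∈A , x∈B | y∈A , y∈B with ≤2 u∈A x∈A y∈A
  ...   | inj₁ refl        = contradiction x∈B u∉B
  ...   | inj₂ (inj₁ refl) = contradiction y∈B u∉B
  ...   | inj₂ (inj₂ x≡y)  = x≡y

  AtMostOne-∪ : ∀ {A B : Subset m} → AtMostOne A → AtMostOne B → AtMostTwo (A ∪ B)
  AtMostOne-∪ {A} {B} ≤1A ≤1B x∈ y∈ z∈ with x∈p∪q⁻ A B x∈ | x∈p∪q⁻ A B y∈ | x∈p∪q⁻ A B z∈
  ... | inj₁ x∈A | inj₁ y∈A | _        = inj₁ (≤1A x∈A y∈A)
  ... | inj₂ x∈B | inj₂ y∈B | _        = inj₁ (≤1B x∈B y∈B)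
  ... | inj₁ x∈A | _        | inj₁ z∈A = inj₂ (inj₁ (≤1A x∈A z∈A))
  ... | inj₂ x∈B | _        | inj₂ z∈B = inj₂ (inj₁ (≤1B x∈B z∈B))
  ... | _        | inj₁ y∈A | inj₁ z∈A = inj₂ (inj₂ (≤1A y∈A z∈A))
  ... | _        | inj₂ y∈B | inj₂ z∈B = inj₂ (inj₂ (≤1B y∈B z∈B))

  data AtMostTwoView (A : Subset m) : Set where
    none : Empty A → AtMostTwoView A
    one  : ∀ b → b ∈ A → (∀ {x} → x ∈ A → x ≡ b) → AtMostTwoView A
    two  : ∀ a b → a ∈ A → b ∈ A → a ≢ b → (∀ {x} → x ∈ A → x ≡ a ⊎ x ≡ b) → AtMostTwoView A

  atMostTwoView : ∀ {A : Subset m} → AtMostTwo A → AtMostTwoView A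
  atMostTwoView {A} ≤2 with nonempty? A
  ... | no ∅A = none ∅A
  ... | yes (a , a∈A) with nonempty? (A - a)
  ...   | no ∅A-a = one a a∈A λ {x} x∈A →
          decidable-stable (x ≟ a) λ x≢a → ∅A-a (x , x∈p∧x≢y⇒x∈p-y x∈A x≢a)
  ...   | yes (b , b∈A-a) = two a b a∈A b∈A a≢b only-a-b
    where
    b∈A = p─q⊆p A ⁅ a ⁆ b∈A-a
    a≢b : a ≢ b
    a≢b a≡b = x∈p-y⇒x≢y b∈A-a (sym a≡b)
    only-a-b : ∀ {x} → x ∈ A → x ≡ a ⊎ x ≡ b
    only-a-b x∈A with ≤2 x∈A a∈A b∈A
    ... | inj₁ x≡a         = inj₁ x≡a
    ... | inj₂ (inj₁ x≡b)  = inj₂ x≡b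
    ... | inj₂ (inj₂ a≡b)  = contradiction a≡b a≢b

module _ {m : ℕ} (G : Graph m) where

  Independent-anti : ∀ {I J} → J ⊆ I → Independent G I → Independent G J
  Independent-anti J⊆I indI i∈J j∈J = indI (J⊆I i∈J) (J⊆I j∈J)

  Independent-∪⁅⁆ : ∀ {I x} → Independent G I → (∀ {y} → y ∈ I → ¬ Adj G x y)
                  → Independent G (I ∪ ⁅ x ⁆)
  Independent-∪⁅⁆ {I} {x} indI x≁I i∈ j∈ with x∈p∪⁅y⁆⁻ I i∈ | x∈p∪⁅y⁆⁻ I j∈
  ... | inj₁ i∈I  | inj₁ j∈I  = indI i∈I j∈I
  ... | inj₂ refl | inj₁ j∈I  = x≁I j∈I
  ... | inj₁ i∈I  | inj₂ refl = x≁I i∈I ∘ Graph.sym G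
  ... | inj₂ refl | inj₂ refl = irrefl G x

  α<-anti : ∀ {U V n} → U ⊆ V → αLess G V n → αLess G U n
  α<-anti U⊆V α<V I I⊆U = α<V I (⊆-trans I⊆U U⊆V)

  α<-mono : ∀ {U n n′} → n ≤ n′ → αLess G U n → αLess G U n′
  α<-mono n≤n′ α<n I I⊆U indI = <-≤-trans (α<n I I⊆U indI) n≤n′

  α<-Empty : ∀ {U n} → Empty U → αLess G U (suc n)
  α<-Empty ∅U I I⊆U _ =
    s≤s (≤-trans (p⊆q⇒∣p∣≤∣q∣ I⊆⊥) (≤-trans (≤-reflexive (∣⊥∣≡0 m)) z≤n))
    where
    I⊆⊥ : I ⊆ ⊥
    I⊆⊥ x∈I = contradiction (_ , I⊆U x∈I) ∅U

  ¬α<1 : ∀ {U x} → x ∈ U → ¬ αLess G U 1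
  ¬α<1 {U} {x} x∈U α<1 = n≮0 (≤-pred (subst (_< 1) (∣⁅x⁆∣≡1 x) (α<1 ⁅ x ⁆ ⁅x⁆⊆U ind⁅x⁆)))
    where
    ⁅x⁆⊆U : ⁅ x ⁆ ⊆ U
    ⁅x⁆⊆U y∈⁅x⁆ = subst (_∈ U) (sym (x∈⁅y⁆⇒x≡y x y∈⁅x⁆)) x∈U
    ind⁅x⁆ : Independent G ⁅ x ⁆
    ind⁅x⁆ i∈ j∈ with x∈⁅y⁆⇒x≡y x i∈ | x∈⁅y⁆⇒x≡y x j∈
    ... | refl | refl = irrefl G x

  α<-∪⁅⁆⁺ : ∀ {U x n} → αLess G U (suc n) → αLess G (U ─ N G x) n → αLess G (U ∪ ⁅ x ⁆) (suc n)
  α<-∪⁅⁆⁺ {U} {x} α<U α<U─Nx I I⊆U∪x indI with x ∈? I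
  ... | no x∉I = α<U I (⊆∪⁅x⁆⇒⊆ x∉I I⊆U∪x) indI
  ... | yes x∈I = ≤-<-trans (∣p∣≤1+∣p-x∣ I x)
                    (s≤s (α<U─Nx (I - x) I-x⊆U─Nx (Independent-anti (p─q⊆p I ⁅ x ⁆) indI)))
    where
    I-x⊆U─Nx : I - x ⊆ U ─ N G x
    I-x⊆U─Nx y∈ = x∈p∧x∉q⇒x∈p─q (⊆∪⁅x⁆⇒⊆ x∉p-x (⊆-trans (p─q⊆p I ⁅ x ⁆) I⊆U∪x) y∈)
                                 (indI x∈I (p─q⊆p I ⁅ x ⁆ y∈))

  α<-∪⁅⁆⁻ : ∀ {U x n} → x ∉ U → αLess G (U ∪ ⁅ x ⁆) (suc n) → αLess G (U ─ N G x) n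
  α<-∪⁅⁆⁻ {U} {x} x∉U α<U∪x J J⊆U─Nx indJ =
    <-≤-trans ∣J∣<∣J∪x∣ (≤-pred (α<U∪x (J ∪ ⁅ x ⁆) (∪⁅⁆-mono (⊆-trans J⊆U─Nx (p─q⊆p U (N G x))))
                                           (Independent-∪⁅⁆ indJ (x∈p─q⇒x∉q ∘ J⊆U─Nx))))
    where
    ∣J∣<∣J∪x∣ : ∣ J ∣ < ∣ J ∪ ⁅ x ⁆ ∣
    ∣J∣<∣J∪x∣ = p⊂q⇒∣p∣<∣q∣ (p⊆p∪q _ , x , x∈p∪⁅x⁆ J , x∉U ∘ p─q⊆p U (N G x) ∘ J⊆U─Nx)

  α<-∪⁅⁆ : ∀ {U x n} → αLess G U n → αLess G (U ∪ ⁅ x ⁆) (suc n)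
  α<-∪⁅⁆ {U} α<U = α<-∪⁅⁆⁺ (α<-mono (n≤1+n _) α<U) (α<-anti (p─q⊆p U _) α<U)

  LinkFace : ℕ → Subset m → Subset m → Set
  LinkFace n S η = αLess G η (suc n) × αLess G (η ─ S) n

  LinkFace-∪⁅⁆ : ∀ {η x n} → x ∉ η → αLess G (η ∪ ⁅ x ⁆) (suc n) ⇔ LinkFace n (N G x) η
  LinkFace-∪⁅⁆ x∉η =
    mk⇔ (λ α<η∪x → α<-anti (p⊆p∪q _) α<η∪x , α<-∪⁅⁆⁻ x∉η α<η∪x)
        (λ (α<η , α<η─Nx) → α<-∪⁅⁆⁺ α<η α<η─Nx)

  LinkFace-disjoint : ∀ {η S n} → Disjoint η S → LinkFace n S η ⇔ αLess G η n
  LinkFace-disjoint η∩S=∅ =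
    mk⇔ (λ (_ , α<η─S) → α<-anti (λ y∈η → x∈p∧x∉q⇒x∈p─q y∈η (η∩S=∅ y∈η)) α<η─S)
        (λ α<η → α<-mono (n≤1+n _) α<η , α<-anti (p─q⊆p _ _) α<η)

  LinkFace-apex : ∀ {η S x n} → x ∈ S → Disjoint η S → LinkFace n S (η ∪ ⁅ x ⁆) ⇔ αLess G η n
  LinkFace-apex {η} {S} x∈S η∩S=∅ =
    mk⇔ (λ (_ , α<η∪x─S) →
          α<-anti (λ y∈η → x∈p∧x∉q⇒x∈p─q (p⊆p∪q _ y∈η) (η∩S=∅ y∈η)) α<η∪x─S)
        (λ α<η → α<-∪⁅⁆ α<η , α<-anti (⊆-trans (p∪⁅x⁆─q⊆p─q x∈S) (p─q⊆p η S)) α<η)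

  LinkFace-absorb : ∀ {η S x n} → x ∈ S → η ─ N G x ⊆ η ─ S
                  → LinkFace n S η ⇔ LinkFace n S (η ∪ ⁅ x ⁆)
  LinkFace-absorb x∈S η─Nx⊆η─S =
    mk⇔ (λ (α<η , α<η─S) → α<-∪⁅⁆⁺ α<η (α<-anti η─Nx⊆η─S α<η─S) ,
                            α<-anti (p∪⁅x⁆─q⊆p─q x∈S) α<η─S)
        (λ (α<η∪x , α<η∪x─S) → α<-anti (p⊆p∪q _) α<η∪x , α<-anti (─-monoˡ (p⊆p∪q _)) α<η∪x─S)

  LinkFace-two-apices : ∀ {η S a b n} → a ∈ S → b ∈ S → a ≢ b → b ∉ N G a → Disjoint η S
                      → LinkFace (suc n) S ((η ∪ ⁅ b ⁆) ∪ ⁅ a ⁆) ⇔ LinkFace n (N G a ∪ N G b) η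
  LinkFace-two-apices {η} {S} {a} {b} {n} a∈S b∈S a≢b b∉Na η∩S=∅ = mk⇔ forth back
    where
    a∉η∪b : a ∉ η ∪ ⁅ b ⁆
    a∉η∪b a∈η∪b with x∈p∪⁅y⁆⁻ η a∈η∪b
    ... | inj₁ a∈η = η∩S=∅ a∈η a∈S
    ... | inj₂ a≡b = a≢b a≡b
    b∉η─Na : b ∉ η ─ N G a
    b∉η─Na b∈η─Na = η∩S=∅ (p─q⊆p η _ b∈η─Na) b∈S
    η∪b─Na≡η─Na∪b : η ∪ ⁅ b ⁆ ─ N G a ≡ (η ─ N G a) ∪ ⁅ b ⁆
    η∪b─Na≡η─Na∪b = p∪⁅x⁆─q≡p─q∪⁅x⁆ b∉Na
    η─Na─Nb≡η─Na∪Nb : η ─ N G a ─ N G b ≡ η ─ (N G a ∪ N G b)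
    η─Na─Nb≡η─Na∪Nb = p─q─r≡p─q∪r η (N G a) (N G b)
    forth : LinkFace (suc n) S ((η ∪ ⁅ b ⁆) ∪ ⁅ a ⁆) → LinkFace n (N G a ∪ N G b) η
    forth (α<η∪b∪a , α<η∪b∪a─S) =
      α<-anti (λ y∈η → x∈p∧x∉q⇒x∈p─q (p⊆p∪q _ (p⊆p∪q _ y∈η)) (η∩S=∅ y∈η)) α<η∪b∪a─S ,
      subst (λ U → αLess G U n) η─Na─Nb≡η─Na∪Nb
        (α<-∪⁅⁆⁻ b∉η─Na (α<-anti (⊆-reflexive (sym η∪b─Na≡η─Na∪b)) (α<-∪⁅⁆⁻ a∉η∪b α<η∪b∪a)))
    back : LinkFace n (N G a ∪ N G b) η → LinkFace (suc n) S ((η ∪ ⁅ b ⁆) ∪ ⁅ a ⁆)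
    back (α<η , α<η─Na∪Nb) =
      α<-∪⁅⁆⁺ (α<-∪⁅⁆ α<η)
        (α<-anti (⊆-reflexive η∪b─Na≡η─Na∪b)
          (α<-∪⁅⁆⁺ (α<-anti (p─q⊆p η _) α<η)
                   (subst (λ U → αLess G U n) (sym η─Na─Nb≡η─Na∪Nb) α<η─Na∪Nb))) ,
      α<-anti (⊆-trans (p∪⁅x⁆─q⊆p─q a∈S) (⊆-trans (p∪⁅x⁆─q⊆p─q b∈S) (p─q⊆p η S))) α<η

module _ {m : ℕ} where

  Within : Subset m → (Subset m → Set) → Family m
  Within W P η = η ⊆ W × P η

  deletion-Within : ∀ {W P v} → deletion (Within W P) v ≐ Within (W - v) P
  deletion-Within =
    (λ (v∉η , η⊆W , Pη) → ⊆⇒⊆-x v∉η η⊆W , Pη) ,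
    (λ (η⊆W-v , Pη) → x∉p-x ∘ η⊆W-v , ⊆-trans η⊆W-v (p─q⊆p _ _) , Pη)

  link-Within : ∀ {W P v} → v ∈ W → link (Within W P) v ≐ Within (W - v) (λ η → P (η ∪ ⁅ v ⁆))
  link-Within v∈W =
    (λ (v∉η , η∪v⊆W , Pη∪v) → ⊆⇒⊆-x v∉η (⊆-trans (p⊆p∪q _) η∪v⊆W) , Pη∪v) ,
    (λ (η⊆W-v , Pη∪v) → x∉p-x ∘ η⊆W-v , p∪⁅x⁆⊆q (⊆-trans η⊆W-v (p─q⊆p _ _)) v∈W , Pη∪v)

  Within-cong : ∀ {W P Q} → (∀ {η} → η ⊆ W → P η ⇔ Q η) → Within W P ≐ Within W Q
  Within-cong P⇔Q =
    (λ (η⊆W , Pη) → η⊆W , to (P⇔Q η⊆W) Pη) , (λ (η⊆W , Qη) → η⊆W , from (P⇔Q η⊆W) Qη)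

module _ {m : ℕ} (G : Graph m) where

  Ind : Subset m → ℕ → Family m
  Ind W n = Within W (λ η → αLess G η n)

  Lk : Subset m → ℕ → Subset m → Family m
  Lk W n S = Within W (LinkFace G n S)

  Ind-⊥ : ∀ {W n} → Ind W (suc n) ⊥
  Ind-⊥ {W} = ⊆-min W , α<-Empty G Empty-⊥

  In≐Ind⊤ : ∀ {n} → In n G ≐ Ind ⊤ n
  In≐Ind⊤ = (λ α<η → ⊆⊤ , α<η) , proj₂

  Ind-link : ∀ {W v n} → v ∈ W → link (Ind W (suc n)) v ≐ Lk (W - v) n (N G v)
  Ind-link {n = n} v∈W =
    ≐-trans (link-Within {P = λ η → αLess G η (suc n)} v∈W)
            (Within-cong λ η⊆W-v → LinkFace-∪⁅⁆ G (x∉p-x ∘ η⊆W-v))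

  Lk-disjoint : ∀ {W S n} → Disjoint W S → Lk W n S ≐ Ind W n
  Lk-disjoint W∩S=∅ = Within-cong λ η⊆W → LinkFace-disjoint G (W∩S=∅ ∘ η⊆W)

  Lk-cone : ∀ {W S b n d} → b ∈ W → b ∈ S → Disjoint (W - b) S
          → Collapsible d (Ind (W - b) n) → Collapsible d (Lk W n S)
  Lk-cone {S = S} {n = n} b∈W b∈S W-b∩S=∅ =
    cone⇒Collapsible _
      (≐-trans (link-Within {P = LinkFace G n S} b∈W)
               (Within-cong λ η⊆W-b → LinkFace-apex G b∈S (W-b∩S=∅ ∘ η⊆W-b)))
      (≐-trans deletion-Within (Lk-disjoint W-b∩S=∅))

  NeighbourOutside : Subset m → Fin m → Set
  NeighbourOutside W x = ∃[ u ] u ∉ W × Adj G x u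

module _ {m : ℕ} (G : Graph m) (maxDeg≤2 : MaxDegreeAtMost 2 G) where

  NeighbourOutside⇒AtMostOne : ∀ {W W′ x} → W′ ⊆ W → NeighbourOutside G W x
                             → AtMostOne (N G x ∩ W′)
  NeighbourOutside⇒AtMostOne W′⊆W (_ , u∉W , x~u) =
    AtMostTwo⇒AtMostOne (∣p∣≤2⇒AtMostTwo (maxDeg≤2 _)) x~u (u∉W ∘ W′⊆W)

  mutual
    Ind-Collapsible : ∀ k W j → ∣ W ∣ ≤ k → Collapsible (2 * j) (Ind G W (suc j))
    Ind-Collapsible k W zero _ =
      emptyFaces⇒Collapsible (Ind-⊥ G) λ (_ , α<1) (_ , x∈η) → ¬α<1 G x∈η α<1
    Ind-Collapsible k W (suc j) ∣W∣≤k with nonempty? W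
    ... | no ∅W = emptyFaces⇒Collapsible (Ind-⊥ G) λ (η⊆W , _) (x , x∈η) → ∅W (x , η⊆W x∈η)
    Ind-Collapsible zero W (suc j) ∣W∣≤0 | yes (v , v∈W) = contradiction (∣p-x∣<k v∈W ∣W∣≤0) n≮0
    Ind-Collapsible (suc k) W (suc j) ∣W∣≤1+k | yes (v , v∈W) =
      Collapsible-mono (≤-reflexive (sym (*-suc 2 j)))
        (link∧deletion⇒Collapsible v (Ind-link G v∈W)
          (Lk-Collapsible k (W - v) j (N G v) ∣W-v∣≤k ≤2 outside-nbr)
          (Collapsible-resp-≐ (≐-sym deletion-Within)
            (Collapsible-mono (≤-reflexive (*-suc 2 j))
              (Ind-Collapsible k (W - v) (suc j) ∣W-v∣≤k))))
      where
      ∣W-v∣≤k = ≤-pred (∣p-x∣<k v∈W ∣W∣≤1+k)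
      ≤2 : AtMostTwo (N G v ∩ (W - v))
      ≤2 = ∣p∣≤2⇒AtMostTwo (≤-trans (∣p∩q∣≤∣p∣ (N G v) (W - v)) (maxDeg≤2 v))
      outside-nbr : ∀ {x} → x ∈ N G v ∩ (W - v) → NeighbourOutside G (W - v) x
      outside-nbr x∈ = v , x∉p-x , Graph.sym G (proj₁ (x∈p∩q⁻ _ _ x∈))

    Lk-Collapsible : ∀ k W j S → ∣ W ∣ ≤ k → AtMostTwo (S ∩ W)
                   → (∀ {x} → x ∈ S ∩ W → NeighbourOutside G W x)
                   → Collapsible (suc (2 * j)) (Lk G W (suc j) S)
    Lk-Collapsible k W j S ∣W∣≤k ≤2 outside-nbr with atMostTwoView ≤2
    ... | none ∅S∩W =
      Collapsible-mono (n≤1+n _)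
        (Collapsible-resp-≐ (≐-sym (Lk-disjoint G W∩S=∅)) (Ind-Collapsible k W j ∣W∣≤k))
      where
      W∩S=∅ : Disjoint W S
      W∩S=∅ x∈W x∈S = ∅S∩W (_ , x∈p∩q⁺ (x∈S , x∈W))
    ... | one b b∈S∩W only-b =
      Collapsible-mono (n≤1+n _)
        (Lk-cone G (proj₂ (x∈p∩q⁻ S W b∈S∩W)) (proj₁ (x∈p∩q⁻ S W b∈S∩W)) W-b∩S=∅
          (Ind-Collapsible k (W - b) j (≤-trans (∣p─q∣≤∣p∣ W ⁅ b ⁆) ∣W∣≤k)))
      where
      W-b∩S=∅ : Disjoint (W - b) S
      W-b∩S=∅ x∈W-b x∈S = x∈p-y⇒x≢y x∈W-b (only-b (x∈p∩q⁺ (x∈S , p─q⊆p W _ x∈W-b)))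
    ... | two a b a∈S∩W b∈S∩W a≢b only-a-b =
      Lk-Collapsible-two k W j S ∣W∣≤k a∈S∩W b∈S∩W a≢b only-a-b
        (outside-nbr a∈S∩W) (outside-nbr b∈S∩W)

    Lk-Collapsible-two : ∀ k W j S {a b} → ∣ W ∣ ≤ k → a ∈ S ∩ W → b ∈ S ∩ W → a ≢ b
                    → (∀ {x} → x ∈ S ∩ W → x ≡ a ⊎ x ≡ b)
                    → NeighbourOutside G W a → NeighbourOutside G W b
                    → Collapsible (suc (2 * j)) (Lk G W (suc j) S)
    Lk-Collapsible-two zero W j S ∣W∣≤0 a∈S∩W _ _ _ _ _ =
      contradiction (∣p-x∣<k (proj₂ (x∈p∩q⁻ S W a∈S∩W)) ∣W∣≤0) n≮0
    Lk-Collapsible-two (suc k) W j S {a} {b} ∣W∣≤1+k a∈S∩W b∈S∩W a≢b only-a-b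
                       outside-nbr-a outside-nbr-b =
      link∧deletion⇒Collapsible a (link-Within {P = LinkFace G (suc j) S} a∈W) link-a
        (Collapsible-resp-≐ (≐-sym deletion-Within) (Collapsible-mono (n≤1+n _) cone-b))
      where
      a∈S = proj₁ (x∈p∩q⁻ S W a∈S∩W)
      a∈W = proj₂ (x∈p∩q⁻ S W a∈S∩W)
      b∈S = proj₁ (x∈p∩q⁻ S W b∈S∩W)
      b∈W-a : b ∈ W - a
      b∈W-a = x∈p∧x≢y⇒x∈p-y (proj₂ (x∈p∩q⁻ S W b∈S∩W)) (a≢b ∘ sym)
      W-a-b⊆W : W - a - b ⊆ W
      W-a-b⊆W = p─q⊆p W _ ∘ p─q⊆p (W - a) _
      W-a-b∩S=∅ : Disjoint (W - a - b) S
      W-a-b∩S=∅ x∈W-a-b x∈S with only-a-b (x∈p∩q⁺ (x∈S , W-a-b⊆W x∈W-a-b))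
      ... | inj₁ refl = x∉p-x (p─q⊆p (W - a) _ x∈W-a-b)
      ... | inj₂ refl = x∉p-x x∈W-a-b
      ∣W-a-b∣≤k = ≤-trans (∣p─q∣≤∣p∣ (W - a) ⁅ b ⁆) (≤-pred (∣p-x∣<k a∈W ∣W∣≤1+k))
      cone-b : Collapsible (2 * j) (Lk G (W - a) (suc j) S)
      cone-b = Lk-cone G b∈W-a b∈S W-a-b∩S=∅ (Ind-Collapsible k (W - a - b) j ∣W-a-b∣≤k)
      link-a : Collapsible (2 * j) (Within (W - a) (λ η → LinkFace G (suc j) S (η ∪ ⁅ a ⁆)))
      link-a with b ∈? N G a
      ... | yes b∈Na =
        Collapsible-resp-≐ (Within-cong λ η⊆W-a → LinkFace-absorb G a∈S (η─Na⊆η─S η⊆W-a)) cone-b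
        where
        W-a∩S⊆Na : ∀ {x} → x ∈ W - a → x ∈ S → x ∈ N G a
        W-a∩S⊆Na x∈W-a x∈S with only-a-b (x∈p∩q⁺ (x∈S , p─q⊆p W _ x∈W-a))
        ... | inj₁ refl = contradiction x∈W-a x∉p-x
        ... | inj₂ refl = b∈Na
        η─Na⊆η─S : ∀ {η} → η ⊆ W - a → η ─ N G a ⊆ η ─ S
        η─Na⊆η─S η⊆W-a x∈η─Na = x∈p∧x∉q⇒x∈p─q (p─q⊆p _ _ x∈η─Na)
          (x∈p─q⇒x∉q x∈η─Na ∘ W-a∩S⊆Na (η⊆W-a (p─q⊆p _ _ x∈η─Na)))
      ... | no b∉Na =
        Lk-link-nonadjacent k j ∣W-a-b∣≤k a∈S b∈S a≢b b∈W-a W-a-b∩S=∅ b∉Na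
          (subst AtMostTwo (sym (∩-distribʳ-∪ (W - a - b) (N G a) (N G b)))
            (AtMostOne-∪ (NeighbourOutside⇒AtMostOne W-a-b⊆W outside-nbr-a)
                         (NeighbourOutside⇒AtMostOne W-a-b⊆W outside-nbr-b)))

    Lk-link-nonadjacent : ∀ k j {W S a b} → ∣ W - a - b ∣ ≤ k → a ∈ S → b ∈ S → a ≢ b → b ∈ W - a
                      → Disjoint (W - a - b) S → b ∉ N G a
                      → AtMostTwo ((N G a ∪ N G b) ∩ (W - a - b))
                      → Collapsible (2 * j) (Within (W - a) (λ η → LinkFace G (suc j) S (η ∪ ⁅ a ⁆)))
    Lk-link-nonadjacent k zero {W} {S} {a} {b} _ a∈S _ _ _ W-a-b∩S=∅ b∉Na _ =
      emptyFaces⇒Collapsible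
        (⊆-min (W - a) , from (LinkFace-apex G a∈S (λ x∈⊥ _ → ∉⊥ x∈⊥)) (α<-Empty G Empty-⊥))
        noVertex
      where
      noVertex : ∀ {η} → η ⊆ W - a × LinkFace G 1 S (η ∪ ⁅ a ⁆) → Empty η
      noVertex {η} (η⊆W-a , α<η∪a , α<η∪a─S) (x , x∈η) =
        ¬α<1 G x∈η─Na (proj₂ (to (LinkFace-∪⁅⁆ G (x∉p-x ∘ η⊆W-a)) α<η∪a))
        where
        x∈S : x ∈ S
        x∈S = decidable-stable (x ∈? S) λ x∉S → ¬α<1 G (x∈p∧x∉q⇒x∈p─q (p⊆p∪q _ x∈η) x∉S) α<η∪a─S
        x≡b : x ≡ b
        x≡b = decidable-stable (x ≟ b) λ x≢b → W-a-b∩S=∅ (x∈p∧x≢y⇒x∈p-y (η⊆W-a x∈η) x≢b) x∈S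
        x∈η─Na : x ∈ η ─ N G a
        x∈η─Na = x∈p∧x∉q⇒x∈p─q x∈η (subst (_∉ N G a) (sym x≡b) b∉Na)
    Lk-link-nonadjacent k (suc j) {W} {S} {a} {b} ∣W-a-b∣≤k a∈S b∈S a≢b b∈W-a W-a-b∩S=∅ b∉Na
                        ≤2 =
      Collapsible-mono (≤-reflexive (sym (*-suc 2 j)))
        (link∧deletion⇒Collapsible b
          (≐-trans (link-Within {P = λ η → LinkFace G (suc (suc j)) S (η ∪ ⁅ a ⁆)} b∈W-a)
                   (Within-cong λ η⊆ → LinkFace-two-apices G a∈S b∈S a≢b b∉Na (W-a-b∩S=∅ ∘ η⊆)))
          (Lk-Collapsible k (W - a - b) j (N G a ∪ N G b) ∣W-a-b∣≤k ≤2 outside-nbr)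
          (Collapsible-resp-≐
            (≐-sym (≐-trans deletion-Within
                            (Within-cong λ η⊆ → LinkFace-apex G a∈S (W-a-b∩S=∅ ∘ η⊆))))
            (Collapsible-mono (≤-reflexive (*-suc 2 j))
              (Ind-Collapsible k (W - a - b) (suc j) ∣W-a-b∣≤k))))
      where
      outside-nbr : ∀ {x} → x ∈ (N G a ∪ N G b) ∩ (W - a - b) → NeighbourOutside G (W - a - b) x
      outside-nbr x∈ with x∈p∪q⁻ (N G a) (N G b) (proj₁ (x∈p∩q⁻ _ _ x∈))
      ... | inj₁ x∈Na = a , x∉p-x ∘ p─q⊆p (W - a) _ , Graph.sym G x∈Na
      ... | inj₂ x∈Nb = b , x∉p-x , Graph.sym G x∈Nb

theorem5p2 : ∀ {m} (G : Graph m) (n : ℕ) → MaxDegreeAtMost 2 G → 1 ≤ n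
           → Collapsible (2 * (n ∸ 1)) (In n G)
theorem5p2 {m} G (suc j) maxDeg≤2 _ =
  Collapsible-resp-≐ (≐-sym (In≐Ind⊤ G)) (Ind-Collapsible G maxDeg≤2 m ⊤ j (∣p∣≤n ⊤))
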